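{- Let $n\ge 5$. For any $g_1,g_2\in A_n$ there exists $g\in A_n$ which is adjacent in $A\Gamma_n$ to both $g_1$ and $g_2$.
   Context: $X=\{1,\dots,n\}$, permutations acting on the right, $A_n$ the alternating group on $X$, $\mathcal{E}_n=\{\sigma\in A_n: i^\sigma\neq i \text{ for all } i\in X\}$. $A\Gamma_n$ is the Cayley graph $\Gamma(A_n,\mathcal{E}_n)$: vertex set $A_n$, edges $\{g,sg\}$ for $g\in A_n$, $s\in\mathcal{E}_n$. -}

module Defs where

open import Data.Nat using (ℕ; _<_; _>_)
open import Data.Nat.Properties using ()
open import Data.Fin using (Fin; toℕ)
open import Data.Fin.Permutation using (Permutation′; _⟨$⟩ʳ_)
open import Data.List using (List; length; filter; cartesianProduct)
open import Data.List using () renaming (allFin to allFinL)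
open import Data.Product using (Σ; _×_; _,_; proj₁; proj₂)
open import Data.Sum using (_⊎_)
open import Data.Nat.Base using (_%_)
open import Relation.Binary.PropositionalEquality using (_≡_; _≢_)
open import Data.Fin.Properties using () renaming (_<?_ to _<ᶠ?_)
open import Relation.Nullary using (Dec)
open import Data.Nat.Properties using (_<?_)
open import Relation.Nullary.Decidable using (_×-dec_)

-- Permutations of X = Fin n (points 0..n-1 stand for 1..n).
-- π ⟨$⟩ʳ i is the image i^π.

inversions : ∀ {n} → Permutation′ n → List (Fin n × Fin n)
inversions {n} π =
  filter (λ p → (proj₁ p <ᶠ? proj₂ p) ×-dec
                (toℕ (π ⟨$⟩ʳ proj₂ p) <? toℕ (π ⟨$⟩ʳ proj₁ p)))
         (cartesianProduct (allFinL n) (allFinL n))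

IsEven : ∀ {n} → Permutation′ n → Set
IsEven π = length (inversions π) % 2 ≡ 0

-- Right-action product: i^(σ τ) = (i^σ)^τ.  Pointwise equality of
-- permutations:  h ≈ₚ σ·g  means  ∀ i, i^h = (i^σ)^g.
IsProduct : ∀ {n} → Permutation′ n → Permutation′ n → Permutation′ n → Set
IsProduct {n} h σ g = ∀ (i : Fin n) → h ⟨$⟩ʳ i ≡ g ⟨$⟩ʳ (σ ⟨$⟩ʳ i)

InE : ∀ {n} → Permutation′ n → Set
InE {n} σ = IsEven σ × (∀ (i : Fin n) → σ ⟨$⟩ʳ i ≢ i)

-- Adjacency in the Cayley graph AΓ_n = Γ(A_n, 𝓔_n): edges {g, s g}.
Adjacent : ∀ {n} → Permutation′ n → Permutation′ n → Set
Adjacent {n} g h =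
  Σ (Permutation′ n) (λ s → InE s × (IsProduct h s g ⊎ IsProduct g s h))

module Submission where

-- Two even permutations g, x of n points are adjacent in AΓ_n as soon as they
-- disagree at every point, since then x = s g for the even fixed-point-free
-- s = x g⁻¹.  So it suffices to find an even g with g i ∉ {g₁ i, g₂ i} for all i;
-- writing g = r g₁ (first r, then g₁), this asks for an even r that moves every
-- point and disagrees everywhere with h = g₂ g₁⁻¹ ("r avoids h").
--
-- Then it shows that for n ≥ 5 every h is avoided by permutations of both signs:
-- n = 5 is checked by computation over an enumeration of all permutations, and
-- n → n + 1 extends an avoider of the permutation h induces on the points 1 … n.
--
-- Conventions: ρ ∘ₚ π is "first ρ, then π", matching the right action of the
-- paper; flip π is the inverse of π, and π ≈ ρ is pointwise equality.

open import Defs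
open import Data.Nat as ℕ using (ℕ; zero; suc; _+_; _≤_; z≤n; _%_; parity)
import Data.Nat.Properties as ℕₚ
open import Data.Fin as Fin using (Fin; zero; suc; toℕ; inject₁)
open import Data.Fin.Patterns using (0F; 1F; 2F)
import Data.Fin.Properties as Finₚ
open import Data.Fin.Permutation
  using (Permutation′; _⟨$⟩ʳ_; _⟨$⟩ˡ_; _∘ₚ_; _≈_; flip; transpose; lift₀; remove; insert;
         inverseˡ; inverseʳ; lift₀-remove; insert-remove)
import Data.Fin.Permutation as Perm
open import Data.Parity.Base using (Parity; 0ℙ; 1ℙ; _⁻¹) renaming (_+_ to _⊕_)
import Data.Parity.Properties as ℙ
open import Data.Bool using (Bool; true; false; _∧_)
import Data.Bool.Properties as Bool
open import Data.List using (List; []; _∷_; _++_; length; filter; cartesianProduct; tabulate; map; concatMap; allFin)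
import Data.List.Properties as Listₚ
open import Data.List.Relation.Unary.All using (All)
import Data.List.Relation.Unary.All as All
open import Data.List.Relation.Unary.Any as Any using (Any; here)
import Data.List.Relation.Unary.Any.Properties as Anyₚ
open import Data.Product using (Σ; ∃; _×_; _,_; proj₁; proj₂)
open import Data.Sum using (_⊎_; inj₁; inj₂; [_,_]′)
open import Data.Empty using (⊥-elim)
open import Function using (_∘_; _⇔_; mk⇔; Equivalence)
open import Function.Bundles using (Injection)
open import Function.Properties.Equivalence using () renaming (refl to ⇔-refl; sym to ⇔-sym)
open import Function.Properties.Inverse using (↔⇒↣)
open import Level using (0ℓ)
open import Relation.Binary.Definitions using (tri<; tri≈; tri>)
open import Relation.Binary.PropositionalEquality
open import Relation.Nullary using (Dec; yes; no; does; ¬_; ¬?; _×-dec_)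
open import Relation.Nullary.Decidable using (dec-true; dec-false; does-⇔; toWitness)
open import Relation.Unary using (Pred; Decidable)
open import Algebra.Properties.CommutativeMonoid.Sum ℕₚ.+-0-commutativeMonoid
  using (sum; sum-cong-≗; sum-replicate-zero; ∑-permute)

𝟙 : Bool → ℕ
𝟙 true  = 1
𝟙 false = 0

length-filter-tabulate : ∀ {A : Set} {n} {P : Pred A 0ℓ} (P? : Decidable P) (f : Fin n → A) →
  length (filter P? (tabulate f)) ≡ sum (λ i → 𝟙 (does (P? (f i))))
length-filter-tabulate {n = zero}  P? f = refl
length-filter-tabulate {n = suc n} P? f with does (P? (f zero))
... | true  = cong suc (length-filter-tabulate P? (f ∘ suc))
... | false = length-filter-tabulate P? (f ∘ suc)

length-filter-product : ∀ {A B : Set} {m n} {P : Pred (A × B) 0ℓ} (P? : Decidable P)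
  (f : Fin m → A) (g : Fin n → B) →
  length (filter P? (cartesianProduct (tabulate f) (tabulate g)))
    ≡ sum (λ i → sum (λ j → 𝟙 (does (P? (f i , g j)))))
length-filter-product {m = zero}  P? f g = refl
length-filter-product {A} {B} {suc m} P? f g = begin
  length (filter P? (first-row ++ rest))
    ≡⟨ cong length (Listₚ.filter-++ P? first-row rest) ⟩
  length (filter P? first-row ++ filter P? rest)
    ≡⟨ Listₚ.length-++ (filter P? first-row) ⟩
  length (filter P? first-row) + length (filter P? rest)
    ≡⟨ cong₂ _+_ (trans (cong (length ∘ filter P?) (Listₚ.map-tabulate g (f zero ,_)))
                        (length-filter-tabulate P? (λ j → f zero , g j)))
                 (length-filter-product P? (f ∘ suc) g) ⟩
  sum (λ i → sum (λ j → 𝟙 (does (P? (f i , g j))))) ∎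
  where
  open ≡-Reasoning
  first-row : List (A × B)
  first-row = map (f zero ,_) (tabulate g)
  rest : List (A × B)
  rest = cartesianProduct (tabulate (f ∘ suc)) (tabulate g)

sum-zero : ∀ {n} (f : Fin n → ℕ) → (∀ i → f i ≡ 0) → sum f ≡ 0
sum-zero {n} f f≡0 = trans (sum-cong-≗ f≡0) (sum-replicate-zero n)

sum-bump : ∀ {n} (f g : Fin n → ℕ) (p : Fin n) →
  (∀ i → i ≢ p → f i ≡ g i) → f p ≡ suc (g p) → sum f ≡ suc (sum g)
sum-bump f g zero    same bump = cong₂ _+_ bump (sum-cong-≗ (λ i → same (suc i) (λ ())))
sum-bump f g (suc p) same bump =
  trans (cong₂ _+_ (same zero (λ ()))
                   (sum-bump (f ∘ suc) (g ∘ suc) p (λ i i≢p → same (suc i) (i≢p ∘ Finₚ.suc-injective)) bump))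
        (ℕₚ.+-suc (g zero) (sum (g ∘ suc)))

sum-mono : ∀ {n} (f g : Fin n → ℕ) → (∀ i → f i ≤ g i) → sum f ≤ sum g
sum-mono {zero}  f g f≤g = z≤n
sum-mono {suc n} f g f≤g = ℕₚ.+-mono-≤ (f≤g zero) (sum-mono (f ∘ suc) (g ∘ suc) (f≤g ∘ suc))

sum-squeeze : ∀ {n} (f g : Fin n → ℕ) → (∀ i → f i ≤ g i) → sum f ≡ sum g → ∀ i → f i ≡ g i
sum-squeeze f g f≤g eq zero = ℕₚ.≤-antisym (f≤g zero) g₀≤f₀
  where
  g₀≤f₀ : g zero ≤ f zero
  g₀≤f₀ = ℕₚ.+-cancelʳ-≤ (sum (g ∘ suc)) (g zero) (f zero)
    (ℕₚ.≤-trans (ℕₚ.≤-reflexive (sym eq)) (ℕₚ.+-mono-≤ ℕₚ.≤-refl (sum-mono (f ∘ suc) (g ∘ suc) (f≤g ∘ suc))))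
sum-squeeze f g f≤g eq (suc i) = sum-squeeze (f ∘ suc) (g ∘ suc) (f≤g ∘ suc) tails-equal i
  where
  tails-equal : sum (f ∘ suc) ≡ sum (g ∘ suc)
  tails-equal = ℕₚ.+-cancelˡ-≡ (f zero) (sum (f ∘ suc)) (sum (g ∘ suc))
    (trans eq (cong (_+ sum (g ∘ suc)) (sym (sum-squeeze f g f≤g eq zero))))

increasing-bound : ∀ {m} (f : Fin (suc m) → ℕ) → (∀ k → f (inject₁ k) ℕ.< f (suc k)) →
                   ∀ {c} → c ≤ f zero → ∀ i → c + toℕ i ≤ f i
increasing-bound f inc {c} c≤f₀ zero = subst (_≤ f zero) (sym (ℕₚ.+-identityʳ c)) c≤f₀
increasing-bound {suc m} f inc {c} c≤f₀ (suc k) =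
  subst (_≤ f (suc k)) (sym (ℕₚ.+-suc c (toℕ k)))
        (increasing-bound (f ∘ suc) (inc ∘ suc) (ℕₚ.≤-<-trans c≤f₀ (inc zero)) k)

permute-injective : ∀ {n} (π : Permutation′ n) {x y} → π ⟨$⟩ʳ x ≡ π ⟨$⟩ʳ y → x ≡ y
permute-injective π = Injection.injective (↔⇒↣ π)

data Position {n} (a b x : Fin n) : Set where
  at-a      : x ≡ a → Position a b x
  at-b      : x ≡ b → Position a b x
  elsewhere : x ≢ a → x ≢ b → Position a b x

position : ∀ {n} (a b x : Fin n) → Position a b x
position a b x with x Finₚ.≟ a | x Finₚ.≟ b
... | yes x≡a | _       = at-a x≡a
... | no  x≢a | yes x≡b = at-b x≡b
... | no  x≢a | no  x≢b = elsewhere x≢a x≢b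

transpose-a : ∀ {n} (a b : Fin n) → transpose a b ⟨$⟩ʳ a ≡ b
transpose-a a b rewrite dec-true (a Finₚ.≟ a) refl = refl

transpose-b : ∀ {n} (a b : Fin n) → transpose a b ⟨$⟩ʳ b ≡ a
transpose-b a b with b Finₚ.≟ a
... | yes b≡a = b≡a
... | no  _   rewrite dec-true (b Finₚ.≟ b) refl = refl

transpose-elsewhere : ∀ {n} (a b x : Fin n) → x ≢ a → x ≢ b → transpose a b ⟨$⟩ʳ x ≡ x
transpose-elsewhere a b x x≢a x≢b
  rewrite dec-false (x Finₚ.≟ a) x≢a | dec-false (x Finₚ.≟ b) x≢b = refl

transpose-involutive : ∀ {n} (a b x : Fin n) → transpose a b ⟨$⟩ʳ (transpose a b ⟨$⟩ʳ x) ≡ x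
transpose-involutive a b x with position a b x
... | at-a refl = trans (cong (transpose a b ⟨$⟩ʳ_) (transpose-a a b)) (transpose-b a b)
... | at-b refl = trans (cong (transpose a b ⟨$⟩ʳ_) (transpose-b a b)) (transpose-a a b)
... | elsewhere x≢a x≢b =
  trans (cong (transpose a b ⟨$⟩ʳ_) (transpose-elsewhere a b x x≢a x≢b)) (transpose-elsewhere a b x x≢a x≢b)

inversion? : ∀ {n} (π : Permutation′ n) (p : Fin n × Fin n) →
  Dec (proj₁ p Fin.< proj₂ p × π ⟨$⟩ʳ proj₂ p Fin.< π ⟨$⟩ʳ proj₁ p)
inversion? π p = (proj₁ p Finₚ.<? proj₂ p) ×-dec (toℕ (π ⟨$⟩ʳ proj₂ p) ℕₚ.<? toℕ (π ⟨$⟩ʳ proj₁ p))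

ι : ∀ {n} → Permutation′ n → Fin n → Fin n → ℕ
ι π i j = 𝟙 (does (inversion? π (i , j)))

count : ∀ {n} → Permutation′ n → ℕ
count π = sum (λ i → sum (λ j → ι π i j))

length-inversions : ∀ {n} (π : Permutation′ n) → length (inversions π) ≡ count π
length-inversions π = length-filter-product (inversion? π) (λ i → i) (λ j → j)

sign : ∀ {n} → Permutation′ n → Parity
sign π = parity (count π)

%2≡0⇔parity≡0ℙ : ∀ k → (k % 2 ≡ 0) ⇔ (parity k ≡ 0ℙ)
%2≡0⇔parity≡0ℙ zero          = mk⇔ (λ _ → refl) (λ _ → refl)
%2≡0⇔parity≡0ℙ (suc zero)    = mk⇔ (λ ()) (λ ())
%2≡0⇔parity≡0ℙ (suc (suc k)) = %2≡0⇔parity≡0ℙ k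

even⇔sign≡0ℙ : ∀ {n} (π : Permutation′ n) → IsEven π ⇔ (sign π ≡ 0ℙ)
even⇔sign≡0ℙ π rewrite length-inversions π = %2≡0⇔parity≡0ℙ (count π)

parity-suc : ∀ k → parity (suc k) ≡ parity k ⁻¹
parity-suc k = trans (sym (ℙ.⁻¹-involutive (parity (suc k)))) (cong _⁻¹ (ℙ.suc-homo-⁻¹ k))

⁻¹-distribˡ-⊕ : ∀ p q → (p ⊕ q) ⁻¹ ≡ p ⁻¹ ⊕ q
⁻¹-distribˡ-⊕ 0ℙ q = refl
⁻¹-distribˡ-⊕ 1ℙ q = ℙ.⁻¹-involutive q

count-cong : ∀ {n} (π ρ : Permutation′ n) → π ≈ ρ → count π ≡ count ρ
count-cong {n} π ρ π≈ρ = sum-cong-≗ {n} (λ i → sum-cong-≗ {n} (λ j →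
  cong₂ (λ x y → 𝟙 (does (i Finₚ.<? j) ∧ does (x Finₚ.<? y))) (π≈ρ j) (π≈ρ i)))

sign-cong : ∀ {n} (π ρ : Permutation′ n) → π ≈ ρ → sign π ≡ sign ρ
sign-cong π ρ π≈ρ = cong parity (count-cong π ρ π≈ρ)

sign-id : ∀ {n} → sign (Perm.id {n}) ≡ 0ℙ
sign-id {n} = cong parity (sum-zero {n} (λ i → sum (ι Perm.id i)) (λ i → sum-zero {n} (ι Perm.id i) (no-inversion i)))
  where
  no-inversion : ∀ i j → ι Perm.id i j ≡ 0
  no-inversion i j with i Finₚ.<? j
  ... | yes i<j rewrite dec-true (i Finₚ.<? j) i<j | dec-false (j Finₚ.<? i) (Finₚ.<-asym i<j) = refl
  ... | no  i≮j rewrite dec-false (i Finₚ.<? j) i≮j = refl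

module AdjacentTransposition {n} (a b : Fin n) (b≡1+a : toℕ b ≡ suc (toℕ a)) where

  s : Permutation′ n
  s = transpose a b

  a<b : a Fin.< b
  a<b = ℕₚ.≤-reflexive (sym b≡1+a)

  -- Since no point lies strictly between a and b, every other point compares
  -- with a as it compares with b.
  below : ∀ {x} → x ≢ a → x ≢ b → (x Fin.< a) ⇔ (x Fin.< b)
  below x≢a x≢b = mk⇔ (λ x<a → Finₚ.<-trans x<a a<b)
    (λ x<b → Finₚ.≤∧≢⇒< (ℕₚ.≤-pred (subst (suc (toℕ _) ℕ.≤_) b≡1+a x<b)) x≢a)

  above : ∀ {x} → x ≢ a → x ≢ b → (a Fin.< x) ⇔ (b Fin.< x)
  above x≢a x≢b = mk⇔
    (λ a<x → Finₚ.≤∧≢⇒< (subst (ℕ._≤ toℕ _) (sym b≡1+a) a<x) (x≢b ∘ sym))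
    (λ b<x → Finₚ.<-trans a<b b<x)

  order-from : ∀ i j {u v} → s ⟨$⟩ʳ i ≡ u → s ⟨$⟩ʳ j ≡ v → (u Fin.< v) ⇔ (i Fin.< j) →
               does (s ⟨$⟩ʳ i Finₚ.<? s ⟨$⟩ʳ j) ≡ does (i Finₚ.<? j)
  order-from i j refl refl u<v⇔i<j = does-⇔ u<v⇔i<j (s ⟨$⟩ʳ i Finₚ.<? s ⟨$⟩ʳ j) (i Finₚ.<? j)

  irrefl-⇔ : ∀ {x y : Fin n} → (x Fin.< x) ⇔ (y Fin.< y)
  irrefl-⇔ = mk⇔ (λ x<x → ⊥-elim (Finₚ.<-irrefl refl x<x)) (λ y<y → ⊥-elim (Finₚ.<-irrefl refl y<y))

  s-order : ∀ i j → ¬ (i ≡ a × j ≡ b) → ¬ (i ≡ b × j ≡ a) →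
            does (s ⟨$⟩ʳ i Finₚ.<? s ⟨$⟩ʳ j) ≡ does (i Finₚ.<? j)
  s-order i j ¬ab ¬ba with position a b i | position a b j
  ... | at-a refl | at-a refl = order-from i j (transpose-a a b) (transpose-a a b) irrefl-⇔
  ... | at-a refl | at-b refl = ⊥-elim (¬ab (refl , refl))
  ... | at-a refl | elsewhere j≢a j≢b =
    order-from i j (transpose-a a b) (transpose-elsewhere a b j j≢a j≢b) (⇔-sym (above j≢a j≢b))
  ... | at-b refl | at-a refl = ⊥-elim (¬ba (refl , refl))
  ... | at-b refl | at-b refl = order-from i j (transpose-b a b) (transpose-b a b) irrefl-⇔
  ... | at-b refl | elsewhere j≢a j≢b =
    order-from i j (transpose-b a b) (transpose-elsewhere a b j j≢a j≢b) (above j≢a j≢b)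
  ... | elsewhere i≢a i≢b | at-a refl =
    order-from i j (transpose-elsewhere a b i i≢a i≢b) (transpose-a a b) (⇔-sym (below i≢a i≢b))
  ... | elsewhere i≢a i≢b | at-b refl =
    order-from i j (transpose-elsewhere a b i i≢a i≢b) (transpose-b a b) (below i≢a i≢b)
  ... | elsewhere i≢a i≢b | elsewhere j≢a j≢b =
    order-from i j (transpose-elsewhere a b i i≢a i≢b) (transpose-elsewhere a b j j≢a j≢b) ⇔-refl

  -- For π with the inversion (a , b), relabelling both indices by s turns the
  -- inversions of π into those of s ∘ₚ π plus the single pair (b , a).
  module _ (π : Permutation′ n) (desc : π ⟨$⟩ʳ b Fin.< π ⟨$⟩ʳ a) where

    ι-s-order : ∀ i j → ¬ (i ≡ a × j ≡ b) → ¬ (i ≡ b × j ≡ a) →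
                ι π (s ⟨$⟩ʳ i) (s ⟨$⟩ʳ j) ≡ ι (s ∘ₚ π) i j
    ι-s-order i j ¬ab ¬ba =
      cong (λ x → 𝟙 (x ∧ does (π ⟨$⟩ʳ (s ⟨$⟩ʳ j) Finₚ.<? π ⟨$⟩ʳ (s ⟨$⟩ʳ i)))) (s-order i j ¬ab ¬ba)

    ι-relabel : ∀ i j → ¬ (i ≡ b × j ≡ a) → ι π (s ⟨$⟩ʳ i) (s ⟨$⟩ʳ j) ≡ ι (s ∘ₚ π) i j
    ι-relabel i j ¬ba with (i Finₚ.≟ a) ×-dec (j Finₚ.≟ b)
    ... | yes (refl , refl)
      rewrite transpose-a a b | transpose-b a b
            | dec-false (b Finₚ.<? a) (Finₚ.<-asym a<b) | dec-true (a Finₚ.<? b) a<b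
            | dec-false (π ⟨$⟩ʳ a Finₚ.<? π ⟨$⟩ʳ b) (Finₚ.<-asym desc) = refl
    ... | no ¬ab = ι-s-order i j ¬ab ¬ba

    ι-bump : ι π (s ⟨$⟩ʳ b) (s ⟨$⟩ʳ a) ≡ suc (ι (s ∘ₚ π) b a)
    ι-bump rewrite transpose-a a b | transpose-b a b
                 | dec-true (a Finₚ.<? b) a<b | dec-true (π ⟨$⟩ʳ b Finₚ.<? π ⟨$⟩ʳ a) desc
                 | dec-false (b Finₚ.<? a) (Finₚ.<-asym a<b) = refl

    count-adjacent : count π ≡ suc (count (s ∘ₚ π))
    count-adjacent = begin
      count π                                            ≡⟨ ∑-permute (λ i → sum (ι π i)) s ⟩
      sum (λ i → sum (λ j → ι π (s ⟨$⟩ʳ i) j))           ≡⟨ sum-cong-≗ (λ i → ∑-permute (ι π (s ⟨$⟩ʳ i)) s) ⟩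
      sum (λ i → sum (λ j → ι π (s ⟨$⟩ʳ i) (s ⟨$⟩ʳ j)))  ≡⟨ sum-bump relabelled-row (λ i → sum (ι (s ∘ₚ π) i)) b
                                                                      other-row row-b ⟩
      suc (count (s ∘ₚ π))                               ∎
      where
      open ≡-Reasoning
      relabelled-row : Fin n → ℕ
      relabelled-row i = sum (λ j → ι π (s ⟨$⟩ʳ i) (s ⟨$⟩ʳ j))
      other-row : ∀ i → i ≢ b → relabelled-row i ≡ sum (ι (s ∘ₚ π) i)
      other-row i i≢b = sum-cong-≗ (λ j → ι-relabel i j (i≢b ∘ proj₁))
      row-b : relabelled-row b ≡ suc (sum (ι (s ∘ₚ π) b))
      row-b = sum-bump (λ j → ι π (s ⟨$⟩ʳ b) (s ⟨$⟩ʳ j)) (ι (s ∘ₚ π) b) a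
                       (λ j j≢a → ι-relabel b j (j≢a ∘ proj₂)) ι-bump

  -- Composing with an adjacent transposition flips the sign: apply
  -- count-adjacent to π or to s ∘ₚ π, whichever has the inversion (a , b).
  sign-adjacent : ∀ π → sign (s ∘ₚ π) ≡ sign π ⁻¹
  sign-adjacent π with Finₚ.<-cmp (π ⟨$⟩ʳ b) (π ⟨$⟩ʳ a)
  ... | tri< πb<πa _ _ = begin
    parity (count (s ∘ₚ π))              ≡⟨ ℙ.suc-homo-⁻¹ (count (s ∘ₚ π)) ⟨
    parity (suc (count (s ∘ₚ π))) ⁻¹     ≡⟨ cong (_⁻¹ ∘ parity) (count-adjacent π πb<πa) ⟨
    sign π ⁻¹                            ∎
    where open ≡-Reasoning
  ... | tri≈ _ πb≡πa _ = ⊥-elim (Finₚ.<-irrefl (sym (permute-injective π πb≡πa)) a<b)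
  ... | tri> _ _ πa<πb = begin
    parity (count (s ∘ₚ π))              ≡⟨ cong parity (count-adjacent (s ∘ₚ π) sπ-desc) ⟩
    parity (suc (count (s ∘ₚ (s ∘ₚ π)))) ≡⟨ cong (parity ∘ suc) (count-cong (s ∘ₚ (s ∘ₚ π)) π
                                              (λ i → cong (π ⟨$⟩ʳ_) (transpose-involutive a b i))) ⟩
    parity (suc (count π))               ≡⟨ parity-suc (count π) ⟩
    sign π ⁻¹                            ∎
    where
    open ≡-Reasoning
    sπ-desc : (s ∘ₚ π) ⟨$⟩ʳ b Fin.< (s ∘ₚ π) ⟨$⟩ʳ a
    sπ-desc = subst₂ Fin._<_ (cong (π ⟨$⟩ʳ_) (sym (transpose-b a b))) (cong (π ⟨$⟩ʳ_) (sym (transpose-a a b))) πa<πb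

-- A permutation without descents is the identity: i ≤ ρ i for all i because ρ
-- is increasing, and both sides have the same sum.
no-descent⇒id : ∀ {m} (ρ : Permutation′ (suc m)) →
  (∀ k → ¬ (ρ ⟨$⟩ʳ suc k Fin.< ρ ⟨$⟩ʳ inject₁ k)) → ρ ≈ Perm.id
no-descent⇒id ρ no-descent i =
  sym (Finₚ.toℕ-injective (sum-squeeze toℕ (toℕ ∘ (ρ ⟨$⟩ʳ_)) i≤ρi (∑-permute toℕ ρ) i))
  where
  ascending : ∀ k → ρ ⟨$⟩ʳ inject₁ k Fin.< ρ ⟨$⟩ʳ suc k
  ascending k = Finₚ.≤∧≢⇒< (ℕₚ.≮⇒≥ (no-descent k))
    (λ eq → ℕₚ.1+n≢n (trans (cong toℕ (sym (permute-injective ρ eq))) (Finₚ.toℕ-inject₁ k)))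
  i≤ρi : ∀ i → toℕ i ≤ toℕ (ρ ⟨$⟩ʳ i)
  i≤ρi = increasing-bound (toℕ ∘ (ρ ⟨$⟩ʳ_)) ascending z≤n

-- The sign is multiplicative, by induction on the number of inversions of ρ
-- (bounded by the fuel c): at a descent k of ρ, with s = (k k+1), we have
-- ρ ≈ s ∘ₚ (s ∘ₚ ρ) and s ∘ₚ ρ has one inversion fewer; without descents ρ = id.
sign-∘-bounded : ∀ {m} c (ρ π : Permutation′ (suc m)) → count ρ ℕ.< c →
                 sign (ρ ∘ₚ π) ≡ sign ρ ⊕ sign π
sign-∘-bounded {m} (suc c) ρ π bound
  with Finₚ.any? (λ k → ρ ⟨$⟩ʳ suc k Finₚ.<? ρ ⟨$⟩ʳ inject₁ k)
... | no ¬descent = begin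
  sign (ρ ∘ₚ π)     ≡⟨ sign-cong (ρ ∘ₚ π) π (λ i → cong (π ⟨$⟩ʳ_) (ρ≈id i)) ⟩
  sign π            ≡⟨ cong (_⊕ sign π) (trans (sign-cong ρ Perm.id ρ≈id) (sign-id {suc m})) ⟨
  sign ρ ⊕ sign π   ∎
  where
  open ≡-Reasoning
  ρ≈id : ρ ≈ Perm.id
  ρ≈id = no-descent⇒id ρ (λ k descent → ¬descent (k , descent))
... | yes (k , descent) = begin
  sign (ρ ∘ₚ π)              ≡⟨ sign-cong (ρ ∘ₚ π) (s ∘ₚ (ρ′ ∘ₚ π))
                                 (λ i → cong (λ x → π ⟨$⟩ʳ (ρ ⟨$⟩ʳ x)) (sym (transpose-involutive _ _ i))) ⟩
  sign (s ∘ₚ (ρ′ ∘ₚ π))      ≡⟨ sign-adjacent (ρ′ ∘ₚ π) ⟩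
  sign (ρ′ ∘ₚ π) ⁻¹          ≡⟨ cong _⁻¹ (sign-∘-bounded c ρ′ π ρ′-bound) ⟩
  (sign ρ′ ⊕ sign π) ⁻¹      ≡⟨ ⁻¹-distribˡ-⊕ (sign ρ′) (sign π) ⟩
  sign ρ′ ⁻¹ ⊕ sign π        ≡⟨ cong (λ p → p ⁻¹ ⊕ sign π) (sign-adjacent ρ) ⟩
  sign ρ ⁻¹ ⁻¹ ⊕ sign π      ≡⟨ cong (_⊕ sign π) (ℙ.⁻¹-involutive (sign ρ)) ⟩
  sign ρ ⊕ sign π            ∎
  where
  open ≡-Reasoning
  open AdjacentTransposition (inject₁ k) (suc k) (cong suc (sym (Finₚ.toℕ-inject₁ k)))
  ρ′ : Permutation′ (suc m)
  ρ′ = s ∘ₚ ρ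
  ρ′-bound : count ρ′ ℕ.< c
  ρ′-bound = ℕₚ.≤-pred (subst (ℕ._< suc c) (count-adjacent ρ descent) bound)

sign-∘ : ∀ {n} (ρ π : Permutation′ n) → sign (ρ ∘ₚ π) ≡ sign ρ ⊕ sign π
sign-∘ {zero}  ρ π = refl
sign-∘ {suc m} ρ π = sign-∘-bounded (suc (count ρ)) ρ π (ℕₚ.n<1+n (count ρ))

sign-flip : ∀ {n} (ρ : Permutation′ n) → sign (flip ρ) ≡ sign ρ
sign-flip {n} ρ = ℙ.+-cancelˡ-≡ (sign ρ) (sign (flip ρ)) (sign ρ) (begin
  sign ρ ⊕ sign (flip ρ)   ≡⟨ sign-∘ ρ (flip ρ) ⟨
  sign (ρ ∘ₚ flip ρ)       ≡⟨ sign-cong (ρ ∘ₚ flip ρ) Perm.id (λ i → inverseˡ ρ) ⟩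
  sign (Perm.id {n})       ≡⟨ sign-id {n} ⟩
  0ℙ                       ≡⟨ ℙ.p+p≡0ℙ (sign ρ) ⟨
  sign ρ ⊕ sign ρ          ∎)
  where open ≡-Reasoning

-- Adding a fixed first point adds no inversions: the new row is zero and the
-- new column is zero by computation.
sign-lift₀ : ∀ {n} (ρ : Permutation′ n) → sign (lift₀ ρ) ≡ sign ρ
sign-lift₀ {n} ρ = cong (λ k → parity (k + count ρ))
  (sum-zero {suc n} (ι (lift₀ ρ) 0F) (λ j → cong 𝟙 (Bool.∧-zeroʳ _)))

-- The transposition (0 c) is odd for every c ≠ 0: (0 1) is adjacent, and
-- (0 c+2) is the conjugate of (1 c+2) = lift₀ (0 c+1) by (0 1).
sign-transpose₀ : ∀ {m} (c : Fin m) → sign (transpose {suc m} 0F (suc c)) ≡ 1ℙ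
sign-transpose₀ {m} zero = begin
  sign s              ≡⟨ sign-cong s (s ∘ₚ id) (λ _ → refl) ⟩
  sign (s ∘ₚ id)      ≡⟨ sign-adjacent id ⟩
  sign id ⁻¹          ≡⟨ cong _⁻¹ (sign-id {suc m}) ⟩
  1ℙ                  ∎
  where
  open ≡-Reasoning
  open AdjacentTransposition {suc m} 0F 1F refl
  id : Permutation′ (suc m)
  id = Perm.id
sign-transpose₀ {suc m} (suc c) = begin
  sign (transpose 0F (suc (suc c)))   ≡⟨ sign-cong (transpose 0F (suc (suc c))) (t ∘ₚ (L ∘ₚ t)) conjugate ⟩
  sign (t ∘ₚ (L ∘ₚ t))                ≡⟨ sign-∘ t (L ∘ₚ t) ⟩
  sign t ⊕ sign (L ∘ₚ t)              ≡⟨ cong (sign t ⊕_) (sign-∘ L t) ⟩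
  sign t ⊕ (sign L ⊕ sign t)          ≡⟨ cong₂ (λ p q → p ⊕ (q ⊕ p)) (sign-transpose₀ {suc m} zero) L-odd ⟩
  1ℙ                                  ∎
  where
  open ≡-Reasoning
  t : Permutation′ (suc (suc m))
  t = transpose 0F 1F
  L : Permutation′ (suc (suc m))
  L = lift₀ (transpose 0F (suc c))
  L-odd : sign L ≡ 1ℙ
  L-odd = trans (sign-lift₀ (transpose 0F (suc c))) (sign-transpose₀ c)
  conjugate : transpose 0F (suc (suc c)) ≈ t ∘ₚ (L ∘ₚ t)
  conjugate 0F = refl
  conjugate 1F = refl
  conjugate (suc (suc y)) with y Finₚ.≟ c
  ... | yes refl = refl
  ... | no  _    = refl

Avoids : ∀ {n} → Permutation′ n → Permutation′ n → Set
Avoids h r = ∀ i → r ⟨$⟩ʳ i ≢ i × r ⟨$⟩ʳ i ≢ h ⟨$⟩ʳ i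

avoids-cong : ∀ {n} (σ h r : Permutation′ n) → σ ≈ h → Avoids σ r → Avoids h r
avoids-cong σ h r σ≈h avoids i = proj₁ (avoids i) , subst (_ ≢_) (σ≈h i) (proj₂ (avoids i))

Avoidable : ℕ → Set
Avoidable n = ∀ (h : Permutation′ n) (e : Parity) → ∃ λ r → Avoids h r × sign r ≡ e

AtMostOnce : ∀ {A : Set} → Pred A 0ℓ → Set
AtMostOnce P = ∀ {x y} → P x → P y → x ≡ y

fails-at-one : ∀ {A : Set} {P : Pred A 0ℓ} → Decidable P → AtMostOnce P →
               ∀ {x y} → x ≢ y → ¬ P x ⊎ ¬ P y
fails-at-one P? P-once {x} x≢y with P? x
... | yes Px = inj₂ (λ Py → x≢y (P-once Px Py))
... | no ¬Px = inj₁ ¬Px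

-- Two predicates holding at most once both fail at one of any three distinct
-- points: if one of them holds at x, it fails at y and z, while the other
-- fails at y or at z.
avoid-two : ∀ {A : Set} {P Q : Pred A 0ℓ} → Decidable P → Decidable Q → AtMostOnce P → AtMostOnce Q →
            ∀ {x y z} → x ≢ y → x ≢ z → y ≢ z → ∃ λ w → ¬ P w × ¬ Q w
avoid-two P? Q? P-once Q-once {x} {y} {z} x≢y x≢z y≢z with P? x | Q? x
... | no ¬Px | no ¬Qx = x , ¬Px , ¬Qx
... | yes Px | _      = [ (λ ¬Qy → y , (λ Py → x≢y (P-once Px Py)) , ¬Qy)
                        , (λ ¬Qz → z , (λ Pz → x≢z (P-once Px Pz)) , ¬Qz) ]′ (fails-at-one Q? Q-once y≢z)
... | no _   | yes Qx = [ (λ ¬Py → y , ¬Py , (λ Qy → x≢y (Q-once Qx Qy)))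
                        , (λ ¬Pz → z , ¬Pz , (λ Qz → x≢z (Q-once Qx Qz))) ]′ (fails-at-one P? P-once y≢z)

-- The permutation of the points 1 … N induced by h on 1 + N points: first swap
-- 0 with its preimage, so that 0 is fixed, then remove 0.
shrink : ∀ {N} → Permutation′ (suc N) → Permutation′ N
shrink h = remove 0F (transpose 0F (h ⟨$⟩ˡ 0F) ∘ₚ h)

shrink-spec : ∀ {N} (h : Permutation′ (suc N)) i →
              h ⟨$⟩ʳ suc i ≡ 0F ⊎ h ⟨$⟩ʳ suc i ≡ suc (shrink h ⟨$⟩ʳ i)
shrink-spec h i = by-cases (suc i Finₚ.≟ z)
  where
  z : Fin _
  z = h ⟨$⟩ˡ 0F
  by-cases : Dec (suc i ≡ z) → h ⟨$⟩ʳ suc i ≡ 0F ⊎ h ⟨$⟩ʳ suc i ≡ suc (shrink h ⟨$⟩ʳ i)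
  by-cases (yes i≡z) = inj₁ (trans (cong (h ⟨$⟩ʳ_) i≡z) (inverseʳ h))
  by-cases (no  i≢z) = inj₂ (trans (cong (h ⟨$⟩ʳ_) (sym (transpose-elsewhere 0F z (suc i) (λ ()) i≢z)))
                                   (sym (lift₀-remove (transpose 0F z ∘ₚ h) (inverseʳ h) (suc i))))

-- Extending an avoider r′ of shrink h to an avoider of h: (0 c+1) ∘ₚ lift₀ r′
-- sends 0 to r′ c + 1, c + 1 to 0, and i + 1 to r′ i + 1 otherwise (the case
-- split on i ≟ c evaluates the transposition).
extend-avoider : ∀ {N} (h : Permutation′ (suc N)) (r′ : Permutation′ N) (c : Fin N) →
  Avoids (shrink h) r′ → h ⟨$⟩ʳ suc c ≢ 0F → suc (r′ ⟨$⟩ʳ c) ≢ h ⟨$⟩ʳ 0F →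
  Avoids h (transpose 0F (suc c) ∘ₚ lift₀ r′)
extend-avoider h r′ c avoids′ hc≢0 r′c≢h0 0F = (λ ()) , r′c≢h0
extend-avoider h r′ c avoids′ hc≢0 r′c≢h0 (suc i) with i Finₚ.≟ c
... | yes refl = (λ ()) , hc≢0 ∘ sym
... | no  i≢c  = proj₁ (avoids′ i) ∘ Finₚ.suc-injective , avoids-h (shrink-spec h i)
  where
  avoids-h : h ⟨$⟩ʳ suc i ≡ 0F ⊎ h ⟨$⟩ʳ suc i ≡ suc (shrink h ⟨$⟩ʳ i) → suc (r′ ⟨$⟩ʳ i) ≢ h ⟨$⟩ʳ suc i
  avoids-h (inj₁ h≡0)      eq with () ← trans eq h≡0
  avoids-h (inj₂ h≡shrink) eq = proj₂ (avoids′ i) (Finₚ.suc-injective (trans eq h≡shrink))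

-- The inductive step: avoid shrink h with the opposite sign, then extend with
-- c ∈ {0, 1, 2} chosen so that h (c+1) ≠ 0 and r′ c + 1 ≠ h 0 (each condition
-- fails for at most one c); the odd transposition (0 c+1) restores the sign.
avoidable-suc : ∀ {m} → Avoidable (3 + m) → Avoidable (4 + m)
avoidable-suc avoidable-N h e with avoidable-N (shrink h) (e ⁻¹)
... | r′ , avoids′ , sign-r′ with avoid-two
        {P = λ i → h ⟨$⟩ʳ suc i ≡ 0F} {Q = λ i → suc (r′ ⟨$⟩ʳ i) ≡ h ⟨$⟩ʳ 0F}
        (λ i → h ⟨$⟩ʳ suc i Finₚ.≟ 0F) (λ i → suc (r′ ⟨$⟩ʳ i) Finₚ.≟ h ⟨$⟩ʳ 0F)
        (λ p q → Finₚ.suc-injective (permute-injective h (trans p (sym q))))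
        (λ p q → permute-injective r′ (Finₚ.suc-injective (trans p (sym q))))
        {0F} {1F} {2F} (λ ()) (λ ()) (λ ())
...   | c , hc≢0 , r′c≢h0 =
  transpose 0F (suc c) ∘ₚ lift₀ r′ , extend-avoider h r′ c avoids′ hc≢0 r′c≢h0 , (begin
    sign (transpose 0F (suc c) ∘ₚ lift₀ r′)         ≡⟨ sign-∘ (transpose 0F (suc c)) (lift₀ r′) ⟩
    sign (transpose 0F (suc c)) ⊕ sign (lift₀ r′)   ≡⟨ cong₂ _⊕_ (sign-transpose₀ c) (trans (sign-lift₀ r′) sign-r′) ⟩
    e ⁻¹ ⁻¹                                         ≡⟨ ℙ.⁻¹-involutive e ⟩
    e                                               ∎)
  where open ≡-Reasoning

-- All permutations of n points: a choice of the image of 0 followed by a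
-- permutation of the remaining points.
permutations : ∀ n → List (Permutation′ n)
permutations zero    = Perm.id ∷ []
permutations (suc n) = concatMap (λ j → map (insert 0F j) (permutations n)) (allFin (suc n))

insert₀-cong : ∀ {n} (j : Fin (suc n)) {σ τ : Permutation′ n} → σ ≈ τ → insert 0F j σ ≈ insert 0F j τ
insert₀-cong j σ≈τ 0F      = refl
insert₀-cong j σ≈τ (suc x) = cong (Fin.punchIn j) (σ≈τ x)

permutations-complete : ∀ {n} (π : Permutation′ n) → Any (_≈ π) (permutations n)
permutations-complete {zero}  π = here (λ ())
permutations-complete {suc n} π =
  Anyₚ.concatMap⁺ _ (Anyₚ.tabulate⁺ {f = λ j → j} (π ⟨$⟩ʳ 0F)
    (Anyₚ.map⁺ (Any.map reinsert (permutations-complete (remove 0F π)))))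
  where
  reinsert : ∀ {σ} → σ ≈ remove 0F π → insert 0F (π ⟨$⟩ʳ 0F) σ ≈ π
  reinsert σ≈ x = trans (insert₀-cong (π ⟨$⟩ʳ 0F) σ≈ x) (insert-remove 0F π x)

avoids? : ∀ {n} (h r : Permutation′ n) → Dec (Avoids h r)
avoids? h r = Finₚ.all? (λ i → ¬? (r ⟨$⟩ʳ i Finₚ.≟ i) ×-dec ¬? (r ⟨$⟩ʳ i Finₚ.≟ h ⟨$⟩ʳ i))

HasAvoider : ∀ {n} → Permutation′ n → Parity → Set
HasAvoider {n} h e = Any (λ r → Avoids h r × sign r ≡ e) (permutations n)

hasAvoider? : ∀ {n} (h : Permutation′ n) (e : Parity) → Dec (HasAvoider h e)
hasAvoider? {n} h e = Any.any? (λ r → avoids? h r ×-dec (sign r ℙ.≟ e)) (permutations n)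

avoiders-5 : All (λ h → HasAvoider h 0ℙ × HasAvoider h 1ℙ) (permutations 5)
avoiders-5 = toWitness {a? = All.all? (λ h → hasAvoider? h 0ℙ ×-dec hasAvoider? h 1ℙ) (permutations 5)} _

-- Every h on 5 points equals a listed σ, and an avoider of σ avoids h.
avoidable-5 : Avoidable 5
avoidable-5 h e = proj₁ avoider , avoids-cong σ h (proj₁ avoider) σ≈h (proj₁ (proj₂ avoider)) , proj₂ (proj₂ avoider)
  where
  σ : Permutation′ 5
  σ = Any.lookup (permutations-complete h)
  found : (HasAvoider σ 0ℙ × HasAvoider σ 1ℙ) × σ ≈ h
  found = All.lookupAny avoiders-5 (permutations-complete h)
  σ≈h : σ ≈ h
  σ≈h = proj₂ found
  select : ∀ e → HasAvoider σ 0ℙ × HasAvoider σ 1ℙ → HasAvoider σ e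
  select 0ℙ = proj₁
  select 1ℙ = proj₂
  avoider : ∃ λ r → Avoids σ r × sign r ≡ e
  avoider = Any.satisfied (select e (proj₁ found))

avoidable : ∀ n → 5 ≤ n → Avoidable n
avoidable n 5≤n = subst Avoidable (ℕₚ.m+[n∸m]≡n 5≤n) (from-5 (n ℕ.∸ 5))
  where
  from-5 : ∀ m → Avoidable (5 + m)
  from-5 zero    = subst Avoidable (sym (ℕₚ.+-identityʳ 5)) avoidable-5
  from-5 (suc m) = subst Avoidable (sym (ℕₚ.+-suc 5 m)) (avoidable-suc (from-5 m))

-- Any two permutations g₁, g₂ admit a permutation of any prescribed sign that
-- disagrees with both everywhere: g = r ∘ₚ g₁ where r avoids g₂ ∘ₚ flip g₁.
disagree-with-both : ∀ {n} → Avoidable n → (g₁ g₂ : Permutation′ n) (e : Parity) →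
  ∃ λ g → sign g ≡ e × (∀ i → g ⟨$⟩ʳ i ≢ g₁ ⟨$⟩ʳ i) × (∀ i → g ⟨$⟩ʳ i ≢ g₂ ⟨$⟩ʳ i)
disagree-with-both avoidable-n g₁ g₂ e with avoidable-n (g₂ ∘ₚ flip g₁) (e ⊕ sign g₁)
... | r , avoids , sign-r = r ∘ₚ g₁ , sign-g , g≢g₁ , g≢g₂
  where
  sign-g : sign (r ∘ₚ g₁) ≡ e
  sign-g = begin
    sign (r ∘ₚ g₁)            ≡⟨ sign-∘ r g₁ ⟩
    sign r ⊕ sign g₁          ≡⟨ cong (_⊕ sign g₁) sign-r ⟩
    (e ⊕ sign g₁) ⊕ sign g₁   ≡⟨ ℙ.+-assoc e (sign g₁) (sign g₁) ⟩
    e ⊕ (sign g₁ ⊕ sign g₁)   ≡⟨ cong (e ⊕_) (ℙ.p+p≡0ℙ (sign g₁)) ⟩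
    e ⊕ 0ℙ                    ≡⟨ ℙ.+-identityʳ e ⟩
    e                         ∎
    where open ≡-Reasoning
  g≢g₁ : ∀ i → g₁ ⟨$⟩ʳ (r ⟨$⟩ʳ i) ≢ g₁ ⟨$⟩ʳ i
  g≢g₁ i = proj₁ (avoids i) ∘ permute-injective g₁
  g≢g₂ : ∀ i → g₁ ⟨$⟩ʳ (r ⟨$⟩ʳ i) ≢ g₂ ⟨$⟩ʳ i
  g≢g₂ i eq = proj₂ (avoids i) (trans (sym (inverseˡ g₁)) (cong (g₁ ⟨$⟩ˡ_) eq))

-- Two even permutations that disagree at every point are adjacent in AΓ_n:
-- x = s g for s = x ∘ₚ flip g, which is even and moves every point.
adjacent-if-disagree : ∀ {n} (g x : Permutation′ n) → IsEven g → IsEven x →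
                       (∀ i → g ⟨$⟩ʳ i ≢ x ⟨$⟩ʳ i) → Adjacent g x
adjacent-if-disagree g x even-g even-x disagree =
  x ∘ₚ flip g , (even-s , s-moves) , inj₁ (λ i → sym (inverseʳ g))
  where
  even-s : IsEven (x ∘ₚ flip g)
  even-s = Equivalence.from (even⇔sign≡0ℙ (x ∘ₚ flip g)) (begin
    sign (x ∘ₚ flip g)       ≡⟨ sign-∘ x (flip g) ⟩
    sign x ⊕ sign (flip g)   ≡⟨ cong₂ _⊕_ (Equivalence.to (even⇔sign≡0ℙ x) even-x)
                                          (trans (sign-flip g) (Equivalence.to (even⇔sign≡0ℙ g) even-g)) ⟩
    0ℙ                       ∎)
    where open ≡-Reasoning
  s-moves : ∀ i → (x ∘ₚ flip g) ⟨$⟩ʳ i ≢ i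
  s-moves i s-fixes = disagree i (trans (cong (g ⟨$⟩ʳ_) (sym s-fixes)) (inverseʳ g))

lemma2p5 : (n : ℕ) → 5 ≤ n → (g₁ g₂ : Permutation′ n) → IsEven g₁ → IsEven g₂ →
    Σ (Permutation′ n) (λ g → IsEven g × Adjacent g g₁ × Adjacent g g₂)
lemma2p5 n 5≤n g₁ g₂ even₁ even₂ with disagree-with-both (avoidable n 5≤n) g₁ g₂ 0ℙ
... | g , sign-g , g≢g₁ , g≢g₂ =
  g , even-g , adjacent-if-disagree g g₁ even-g even₁ g≢g₁ , adjacent-if-disagree g g₂ even-g even₂ g≢g₂
  where
  even-g : IsEven g
  even-g = Equivalence.from (even⇔sign≡0ℙ g) sign-g
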